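{- Let $k\ge1$, $n=k^2$ and $m\le n$. Every $(m,k,n)$-Sudoku rectangle can be extended to an $(m,n,n)$-Sudoku rectangle.
   Context: For $n=k^2$, an $n\times n$ matrix is divided into $k^2$ blocks: for $i,j\in[k]$ the $(i,j)$th block consists of the cells $((i-1)k+x,(j-1)k+y)$, $x,y\in[k]$. A partial Sudoku square of order $n$ is an $n\times n$ matrix with entries in $\{1,\dots,n\}\cup\{*\}$ ($*$ meaning an empty cell) such that each number of $\{1,\dots,n\}$ appears at most once in each row, at most once in each column, and at most once in each block. A partial Sudoku square $P_2$ extends $P_1$ (same order) if every nonempty cell of $P_1$ has the same entry in $P_2$. For $p,q\le n$, a $(p,q,n)$-Sudoku rectangle is a partial Sudoku square of order $n$ in which all cells lying in the intersection of the first $p$ rows and the first $q$ columns are filled and all remaining cells are empty. -}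

module Defs where

open import Data.Nat using (ℕ; suc; _*_; _<_; _≤_)
open import Data.Nat.DivMod using (_/_)
open import Data.Fin using (Fin; toℕ)
open import Data.Maybe using (Maybe; just; nothing)
open import Data.Product using (_×_)
open import Data.Sum using (_⊎_)
open import Relation.Binary.PropositionalEquality using (_≡_; _≢_)

-- A matrix of order n: cell (r , c) holds 'nothing' (the empty cell *)
-- or 'just s', where the symbol s : Fin n stands for the number toℕ s + 1.
-- Rows/columns are 0-indexed: Fin-index r stands for row r + 1.
Matrix : ℕ → Set
Matrix n = Fin n → Fin n → Maybe (Fin n)

-- Block side length k ≥ 1 is written as suc k' ; order n = k * k.
-- Cells (r , c) and (r' , c') lie in the same block iff
-- ⌊r/k⌋ = ⌊r'/k⌋ and ⌊c/k⌋ = ⌊c'/k⌋ (0-indexed).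
SameBlock : (k : ℕ) → Fin (suc k * suc k) → Fin (suc k * suc k)
          → Fin (suc k * suc k) → Fin (suc k * suc k) → Set
SameBlock k r c r' c' =
  (toℕ r / suc k ≡ toℕ r' / suc k) × (toℕ c / suc k ≡ toℕ c' / suc k)

record PartialSudoku (k : ℕ) (P : Matrix (suc k * suc k)) : Set where
  field
    rowOK   : ∀ r c c' s → P r c ≡ just s → P r c' ≡ just s → c ≡ c'
    colOK   : ∀ r r' c s → P r c ≡ just s → P r' c ≡ just s → r ≡ r'
    blockOK : ∀ r c r' c' s → SameBlock k r c r' c' →
              P r c ≡ just s → P r' c' ≡ just s → (r ≡ r' × c ≡ c')

Extends : ∀ {n} → Matrix n → Matrix n → Set
Extends {n} P₁ P₂ = ∀ r c s → P₁ r c ≡ just s → P₂ r c ≡ just s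

record SudokuRectangle (k p q : ℕ) (P : Matrix (suc k * suc k)) : Set where
  field
    partial : PartialSudoku k P
    filled  : ∀ r c → toℕ r < p → toℕ c < q → P r c ≢ nothing
    empty   : ∀ r c → (p ≤ toℕ r ⊎ q ≤ toℕ c) → P r c ≡ nothing

{-# OPTIONS --safe #-}
-- Complete each block of the first stack: the entries of P there form a partial injection
-- from the n cells of the block to the n symbols, which extends to a bijection. In stack j,
-- give row i of band b the symbols of row i + j (mod k) of the completed block of band b.
-- Then every row and every block receives each symbol exactly once, and within a stack each
-- symbol lies in the set of exactly one row per band, i.e. of k rows. Ordering the k symbols of
-- every row inside a stack so that no column repeats a symbol is a proper k-edge-colouring of a
-- bipartite multigraph of maximum degree k; as in König's theorem it is built by inserting the
-- symbols one at a time and, on a conflict, swapping two columns along an alternating (Kempe)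
-- chain. Finally the rows from m on are emptied.
module Submission where

open import Defs
open import Data.Nat as ℕ using (ℕ; zero; suc; _+_; _*_; _∸_; _<_; _≤_; NonZero)
import Data.Nat.Properties as ℕ
open import Data.Nat.DivMod
  using (_%_; _/_; m%n<n; m<n⇒m%n≡m; [m+n]%n≡m%n; %-distribˡ-+; m<n⇒m/n≡0; m*n/n≡m; +-distrib-/-∣ˡ)
open import Data.Nat.Divisibility using (m∣m*n)
open import Data.Fin using (Fin; toℕ; fromℕ<; punchOut; combine; quotient; remainder)
open import Data.Fin.Properties
  using (_≟_; any?; combine-injective; combine-remQuot; remQuot-combine; combine-surjective; fromℕ<-toℕ; pigeonhole;
         punchOut-injective; toℕ-combine; toℕ-fromℕ<; toℕ-injective; toℕ<n; <⇒≢)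
open import Data.Fin.Permutation.Components using (transpose; transpose-inverse)
open import Data.Maybe using (Maybe; just; nothing)
open import Data.Maybe.Properties using (just-injective; ≡-dec)
open import Data.Product using (Σ; ∃; _×_; _,_; proj₁; proj₂)
open import Data.Sum using (_⊎_; inj₁; inj₂; map₁)
open import Data.Empty using (⊥; ⊥-elim)
open import Data.Vec.Functional using (updateAt)
open import Data.Vec.Functional.Properties using (updateAt-updates; updateAt-minimal)
open import Function using (_∘_; const; id)
open import Function.Definitions using (Injective)
open import Relation.Nullary using (¬_; Dec; yes; no; ¬?)
open import Relation.Nullary.Decidable using (decidable-stable; _×-dec_)
open import Relation.Unary using (Decidable)
open import Relation.Binary.PropositionalEquality
open ≡-Reasoning

private variable
  n : ℕ

just≢nothing : ∀ {A : Set} {a : A} → just a ≢ nothing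
just≢nothing ()

IsDefined : {A : Set} → Maybe A → Set
IsDefined {A} m = ∃ λ (a : A) → m ≡ just a

defined-or-empty : {A : Set} (m : Maybe A) → IsDefined m ⊎ m ≡ nothing
defined-or-empty (just a) = inj₁ (a , refl)
defined-or-empty nothing = inj₂ refl

injective⇒surjective : (f : Fin n → Fin n) → Injective _≡_ _≡_ f → ∀ y → ∃ λ x → f x ≡ y
injective⇒surjective {suc n} f f-inj y with any? (λ x → f x ≟ y)
... | yes hit = hit
... | no miss =
  let i , j , i<j , punch-eq = pigeonhole (ℕ.n<1+n n) (λ x → punchOut (y≢f x))
  in  ⊥-elim (<⇒≢ i<j (f-inj (punchOut-injective (y≢f i) (y≢f j) punch-eq)))
  where
  y≢f : ∀ x → y ≢ f x
  y≢f x y≡fx = miss (x , sym y≡fx)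

PartialInjection : (Fin n → Maybe (Fin n)) → Set
PartialInjection g = ∀ {x y v} → g x ≡ just v → g y ≡ just v → x ≡ y

_⊑_ : (Fin n → Maybe (Fin n)) → (Fin n → Maybe (Fin n)) → Set
g ⊑ h = ∀ {x v} → g x ≡ just v → h x ≡ just v

Hits : (Fin n → Maybe (Fin n)) → Fin n → Set
Hits g v = ∃ λ x → g x ≡ just v

hits? : ∀ (g : Fin n → Maybe (Fin n)) v → Dec (Hits g v)
hits? g v = any? (λ x → ≡-dec _≟_ (g x) (just v))

module _ {g : Fin n → Maybe (Fin n)} (g-inj : PartialInjection g) where

  unused-value : ∀ {x₀} → g x₀ ≡ nothing → ∃ λ v → ¬ Hits g v
  unused-value {x₀} gx₀≡nothing with any? (λ v → ¬? (hits? g v))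
  ... | yes unused = unused
  ... | no all-hit =
    let v , preimage-v≡x₀ = injective⇒surjective preimage preimage-injective x₀
    in  ⊥-elim (just≢nothing (trans (sym (preimage-maps v)) (trans (cong g preimage-v≡x₀) gx₀≡nothing)))
    where
    hit : ∀ v → Hits g v
    hit v = decidable-stable (hits? g v) (λ miss → all-hit (v , miss))
    preimage : Fin n → Fin n
    preimage v = proj₁ (hit v)
    preimage-maps : ∀ v → g (preimage v) ≡ just v
    preimage-maps v = proj₂ (hit v)
    preimage-injective : Injective _≡_ _≡_ preimage
    preimage-injective {v} {w} eq =
      just-injective (trans (sym (preimage-maps v)) (trans (cong g eq) (preimage-maps w)))

  assign : Fin n → Fin n → Fin n → Maybe (Fin n)
  assign x₀ v = updateAt g x₀ (const (just v))

  assign-view : ∀ x₀ v x → (x ≡ x₀ × assign x₀ v x ≡ just v) ⊎ (x ≢ x₀ × assign x₀ v x ≡ g x)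
  assign-view x₀ v x with x ≟ x₀
  ... | yes refl = inj₁ (refl , updateAt-updates x₀ g)
  ... | no x≢x₀ = inj₂ (x≢x₀ , updateAt-minimal x x₀ g x≢x₀)

  assign-injective : ∀ {x₀ v} → ¬ Hits g v → PartialInjection (assign x₀ v)
  assign-injective {x₀} {v} unused {x} {y} hx hy with assign-view x₀ v x | assign-view x₀ v y
  ... | inj₁ (refl , _) | inj₁ (refl , _) = refl
  ... | inj₁ (_ , hx₀) | inj₂ (_ , hy≡gy) =
    ⊥-elim (unused (y , trans (sym hy≡gy) (trans hy (trans (sym hx) hx₀))))
  ... | inj₂ (_ , hx≡gx) | inj₁ (_ , hy₀) =
    ⊥-elim (unused (x , trans (sym hx≡gx) (trans hx (trans (sym hy) hy₀))))
  ... | inj₂ (_ , hx≡gx) | inj₂ (_ , hy≡gy) = g-inj (trans (sym hx≡gx) hx) (trans (sym hy≡gy) hy)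

  assign-extends : ∀ {x₀ v} → g x₀ ≡ nothing → g ⊑ assign x₀ v
  assign-extends {x₀} {v} gx₀ {x} gx with assign-view x₀ v x
  ... | inj₁ (refl , _) = ⊥-elim (just≢nothing (trans (sym gx) gx₀))
  ... | inj₂ (_ , hx≡gx) = trans hx≡gx gx

  define-at : ∀ x₀ → ∃ λ h → PartialInjection h × g ⊑ h × IsDefined (h x₀)
  define-at x₀ with g x₀ in gx₀
  ... | just v = g , g-inj , id , v , gx₀
  ... | nothing =
    let v , unused = unused-value gx₀
    in  assign x₀ v , assign-injective unused , assign-extends gx₀ , v , updateAt-updates x₀ g

defined-below : ∀ {g : Fin n → Maybe (Fin n)} → PartialInjection g → ∀ i →
                ∃ λ h → PartialInjection h × g ⊑ h × (∀ x → toℕ x < i → IsDefined (h x))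
defined-below g-inj zero = _ , g-inj , id , λ _ ()
defined-below {n} g-inj (suc i) with defined-below g-inj i
... | h , h-inj , g⊑h , below with i ℕ.<? n
...   | no i≮n = h , h-inj , g⊑h , λ x _ → below x (ℕ.<-≤-trans (toℕ<n x) (ℕ.≮⇒≥ i≮n))
...   | yes i<n with define-at h-inj (fromℕ< i<n)
...     | h′ , h′-inj , h⊑h′ , defined-at-i = h′ , h′-inj , h⊑h′ ∘ g⊑h , below′
  where
  below′ : ∀ x → toℕ x < suc i → IsDefined (h′ x)
  below′ x x<1+i with ℕ.m≤n⇒m<n∨m≡n (ℕ.s≤s⁻¹ x<1+i)
  ... | inj₁ x<i = let v , hx = below x x<i in v , h⊑h′ hx
  ... | inj₂ refl = subst (IsDefined ∘ h′) (fromℕ<-toℕ x i<n) defined-at-i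

extend-partial-injection : ∀ {g : Fin n → Maybe (Fin n)} → PartialInjection g →
  ∃ λ f → Injective _≡_ _≡_ f × (∀ {x v} → g x ≡ just v → f x ≡ v)
extend-partial-injection {n} {g} g-inj with defined-below g-inj n
... | h , h-inj , g⊑h , defined = f , f-injective , f-extends
  where
  f : Fin n → Fin n
  f x = proj₁ (defined x (toℕ<n x))
  h≡f : ∀ x → h x ≡ just (f x)
  h≡f x = proj₂ (defined x (toℕ<n x))
  f-injective : Injective _≡_ _≡_ f
  f-injective {x} {y} fx≡fy = h-inj (h≡f x) (trans (h≡f y) (cong just (sym fx≡fy)))
  f-extends : ∀ {x v} → g x ≡ just v → f x ≡ v
  f-extends {x} gx = just-injective (trans (sym (h≡f x)) (g⊑h gx))

transpose-cases : (i j k : Fin n) →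
  (k ≡ i × transpose i j k ≡ j) ⊎ (k ≡ j × transpose i j k ≡ i) ⊎ transpose i j k ≡ k
transpose-cases i j k with k ≟ i
... | yes k≡i = inj₁ (k≡i , refl)
... | no _ with k ≟ j
...   | yes k≡j = inj₂ (inj₁ (k≡j , refl))
...   | no _ = inj₂ (inj₂ refl)

transpose-injective : ∀ (i j : Fin n) {k k′} → transpose i j k ≡ transpose i j k′ → k ≡ k′
transpose-injective i j {k} {k′} eq =
  trans (sym (transpose-inverse j i)) (trans (cong (transpose j i) eq) (transpose-inverse j i))

transpose-at-i : (i j : Fin n) → transpose i j i ≡ j
transpose-at-i i j with i ≟ i
... | yes _ = refl
... | no i≢i = ⊥-elim (i≢i refl)

Array : ℕ → ℕ → ℕ → Set
Array R K N = Fin R → Fin K → Maybe (Fin N)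

module _ {R K N : ℕ} where

  RowLatin : Array R K N → Set
  RowLatin T = ∀ {r c c′ s} → T r c ≡ just s → T r c′ ≡ just s → c ≡ c′

  ColumnLatin : Array R K N → Set
  ColumnLatin T = ∀ {r r′ c s} → T r c ≡ just s → T r′ c ≡ just s → r ≡ r′

  InRow : Array R K N → Fin R → Fin N → Set
  InRow T r s = ∃ λ c → T r c ≡ just s

  InColumn : Array R K N → Fin K → Fin N → Set
  InColumn T c s = ∃ λ r → T r c ≡ just s

  record Insertion (T : Array R K N) (r₀ : Fin R) (s : Fin N) : Set where
    field
      array        : Array R K N
      row-latin    : RowLatin array
      column-latin : ColumnLatin array
      keeps        : ∀ {r y} → InRow T r y → InRow array r y
      adds-only    : ∀ {r y} → InRow array r y → InRow T r y ⊎ (r ≡ r₀ × y ≡ s)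
      inserts      : InRow array r₀ s

  module Place (T : Array R K N) (r₀ : Fin R) (α : Fin K) (s : Fin N) where

    placed : Array R K N
    placed r c with r ≟ r₀ | c ≟ α
    ... | yes _ | yes _ = just s
    ... | _     | _     = T r c

    placed-view : ∀ r c → (r ≡ r₀ × c ≡ α × placed r c ≡ just s)
                        ⊎ (¬ (r ≡ r₀ × c ≡ α) × placed r c ≡ T r c)
    placed-view r c with r ≟ r₀ | c ≟ α
    ... | yes r≡r₀ | yes c≡α = inj₁ (r≡r₀ , c≡α , refl)
    ... | yes _    | no c≢α  = inj₂ (c≢α ∘ proj₂ , refl)
    ... | no r≢r₀  | _       = inj₂ (r≢r₀ ∘ proj₁ , refl)

    placed-at : placed r₀ α ≡ just s
    placed-at with placed-view r₀ α
    ... | inj₁ (_ , _ , q) = q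
    ... | inj₂ (≢ , _) = ⊥-elim (≢ (refl , refl))

    module _ (row-latin : RowLatin T) (column-latin : ColumnLatin T) (empty : T r₀ α ≡ nothing)
             (∉row : ¬ InRow T r₀ s) (∉column : ¬ InColumn T α s) where

      placed-row-latin : RowLatin placed
      placed-row-latin {r} {c} {c′} p p′ with placed-view r c | placed-view r c′
      ... | inj₁ (_ , refl , _) | inj₁ (_ , refl , _) = refl
      ... | inj₁ (refl , _ , q) | inj₂ (_ , q′) =
        ⊥-elim (∉row (c′ , trans (sym q′) (trans p′ (trans (sym p) q))))
      ... | inj₂ (_ , q) | inj₁ (refl , _ , q′) =
        ⊥-elim (∉row (c , trans (sym q) (trans p (trans (sym p′) q′))))
      ... | inj₂ (_ , q) | inj₂ (_ , q′) = row-latin (trans (sym q) p) (trans (sym q′) p′)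

      placed-column-latin : ColumnLatin placed
      placed-column-latin {r} {r′} {c} p p′ with placed-view r c | placed-view r′ c
      ... | inj₁ (refl , _ , _) | inj₁ (refl , _ , _) = refl
      ... | inj₁ (_ , refl , q) | inj₂ (_ , q′) =
        ⊥-elim (∉column (r′ , trans (sym q′) (trans p′ (trans (sym p) q))))
      ... | inj₂ (_ , q) | inj₁ (_ , refl , q′) =
        ⊥-elim (∉column (r , trans (sym q) (trans p (trans (sym p′) q′))))
      ... | inj₂ (_ , q) | inj₂ (_ , q′) = column-latin (trans (sym q) p) (trans (sym q′) p′)

      placed-keeps : ∀ {r y} → InRow T r y → InRow placed r y
      placed-keeps {r} {y} (c , p) with placed-view r c
      ... | inj₁ (refl , refl , _) = ⊥-elim (just≢nothing (trans (sym p) empty))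
      ... | inj₂ (_ , q) = c , trans q p

      placed-adds-only : ∀ {r y} → InRow placed r y → InRow T r y ⊎ (r ≡ r₀ × y ≡ s)
      placed-adds-only {r} {y} (c , p) with placed-view r c
      ... | inj₁ (r≡r₀ , _ , q) = inj₂ (r≡r₀ , just-injective (trans (sym p) q))
      ... | inj₂ (_ , q) = inj₁ (c , trans (sym q) p)

      place : Insertion T r₀ s
      place = record
        { array = placed ; row-latin = λ {r} → placed-row-latin {r} ; column-latin = placed-column-latin
        ; keeps = placed-keeps ; adds-only = placed-adds-only
        ; inserts = α , placed-at }

  Link : Array R K N → Fin K → Fin K → Fin R → Fin R → Set
  Link T α β a b = ∃ λ y → T a β ≡ just y × T b α ≡ just y

  module Swap (T : Array R K N) (α β : Fin K) {C : Fin R → Set} (C? : Decidable C)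
              (closed : ∀ {a b} → Link T α β a b → (C a → C b) × (C b → C a)) where

    swapped : Array R K N
    swapped r c with C? r
    ... | yes _ = T r (transpose α β c)
    ... | no  _ = T r c

    swapped-view : ∀ r c → (C r × swapped r c ≡ T r (transpose α β c)) ⊎ (¬ C r × swapped r c ≡ T r c)
    swapped-view r c with C? r
    ... | yes r∈C = inj₁ (r∈C , refl)
    ... | no  r∉C = inj₂ (r∉C , refl)

    swapped-outside : ∀ {r} → ¬ C r → ∀ c → swapped r c ≡ T r c
    swapped-outside {r} r∉C c with swapped-view r c
    ... | inj₁ (r∈C , _) = ⊥-elim (r∉C r∈C)
    ... | inj₂ (_ , q) = q

    swapped-row-latin : RowLatin T → RowLatin swapped
    swapped-row-latin row-latin {r} {c} {c′} p p′ with swapped-view r c | swapped-view r c′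
    ... | inj₁ (_ , q) | inj₁ (_ , q′) = transpose-injective α β (row-latin {r} (trans (sym q) p) (trans (sym q′) p′))
    ... | inj₁ (r∈C , _) | inj₂ (r∉C , _) = ⊥-elim (r∉C r∈C)
    ... | inj₂ (r∉C , _) | inj₁ (r∈C , _) = ⊥-elim (r∉C r∈C)
    ... | inj₂ (_ , q) | inj₂ (_ , q′) = row-latin {r} (trans (sym q) p) (trans (sym q′) p′)

    module _ (column-latin : ColumnLatin T) where

      private
        no-clash : ∀ {r r′ c y} → C r → ¬ C r′ → T r (transpose α β c) ≡ just y → T r′ c ≡ just y → ⊥
        no-clash {r} {r′} {c} r∈C r′∉C p p′ with transpose-cases α β c
        ... | inj₁ (refl , q) = r′∉C (proj₁ (closed (_ , trans (cong (T r) (sym q)) p , p′)) r∈C)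
        ... | inj₂ (inj₁ (refl , q)) = r′∉C (proj₂ (closed (_ , p′ , trans (cong (T r) (sym q)) p)) r∈C)
        ... | inj₂ (inj₂ q) = r′∉C (subst C (column-latin (trans (cong (T r) (sym q)) p) p′) r∈C)

      swapped-column-latin : ColumnLatin swapped
      swapped-column-latin {r} {r′} {c} p p′ with swapped-view r c | swapped-view r′ c
      ... | inj₁ (_ , q) | inj₁ (_ , q′) = column-latin (trans (sym q) p) (trans (sym q′) p′)
      ... | inj₁ (r∈C , q) | inj₂ (r′∉C , q′) =
        ⊥-elim (no-clash r∈C r′∉C (trans (sym q) p) (trans (sym q′) p′))
      ... | inj₂ (r∉C , q) | inj₁ (r′∈C , q′) =
        ⊥-elim (no-clash r′∈C r∉C (trans (sym q′) p′) (trans (sym q) p))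
      ... | inj₂ (_ , q) | inj₂ (_ , q′) = column-latin (trans (sym q) p) (trans (sym q′) p′)

    swapped-keeps : ∀ {r y} → InRow T r y → InRow swapped r y
    swapped-keeps {r} (c , p) with swapped-view r (transpose β α c)
    ... | inj₁ (_ , q) = transpose β α c , trans q (trans (cong (T r) (transpose-inverse α β)) p)
    ... | inj₂ (r∉C , _) = c , trans (swapped-outside r∉C c) p

    swapped-adds-nothing : ∀ {r y} → InRow swapped r y → InRow T r y
    swapped-adds-nothing {r} (c , p) with swapped-view r c
    ... | inj₁ (_ , q) = transpose α β c , trans (sym q) p
    ... | inj₂ (_ , q) = c , trans (sym q) p

  module KempeChain (T : Array R K N) (column-latin : ColumnLatin T) (α β : Fin K) {s : Fin N}
                    (s∉β : ¬ InColumn T β s) {r₁ : Fin R} (r₁-α : T r₁ α ≡ just s) where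

    link? : ∀ a b → Dec (Link T α β a b)
    link? a b with T a β | T b α
    ... | nothing | _       = no λ { (_ , () , _) }
    ... | just _  | nothing = no λ { (_ , _ , ()) }
    ... | just y  | just z with y ≟ z
    ...   | yes refl = yes (y , refl , refl)
    ...   | no  y≢z  = no λ { (_ , refl , refl) → y≢z refl }

    link-injective : ∀ {a a′ b} → Link T α β a b → Link T α β a′ b → a ≡ a′
    link-injective (y , p , q) (y′ , p′ , q′) with trans (sym q) q′
    ... | refl = column-latin p p′

    no-link-into-r₁ : ∀ {a} → ¬ Link T α β a r₁
    no-link-into-r₁ {a} (y , p , q) with trans (sym r₁-α) q
    ... | refl = s∉β (a , p)

    Walk : ℕ → Fin R → Set
    Walk zero    b = b ≡ r₁
    Walk (suc i) b = ∃ λ a → Walk i a × Link T α β a b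

    walk? : ∀ i → Decidable (Walk i)
    walk? zero    b = b ≟ r₁
    walk? (suc i) b = any? (λ a → walk? i a ×-dec link? a b)

    walk-index-unique : ∀ {i j b} → Walk i b → Walk j b → i ≡ j
    walk-index-unique {zero}  {zero}  _ _ = refl
    walk-index-unique {zero}  {suc j} refl (_ , _ , l) = ⊥-elim (no-link-into-r₁ l)
    walk-index-unique {suc i} {zero}  (_ , _ , l) refl = ⊥-elim (no-link-into-r₁ l)
    walk-index-unique {suc i} {suc j} (a , w , l) (a′ , w′ , l′) with link-injective l l′
    ... | refl = cong suc (walk-index-unique w w′)

    walk-prefix : ∀ {i b} → Walk i b → ∀ j → j ≤ i → ∃ (Walk j)
    walk-prefix {i} {b} w j j≤i with j ℕ.≟ i
    ... | yes refl = b , w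
    walk-prefix {suc i} (a , w , _) j j≤1+i | no j≢1+i =
      walk-prefix w j (ℕ.s≤s⁻¹ (ℕ.≤∧≢⇒< j≤1+i j≢1+i))
    walk-prefix {zero} _ j j≤0 | no j≢0 = ⊥-elim (j≢0 (ℕ.n≤0⇒n≡0 j≤0))

    -- The walk visits pairwise distinct rows, so it is shorter than R.
    walk-length< : ∀ {i b} → Walk i b → i < R
    walk-length< {i} w with i ℕ.<? R
    ... | yes i<R = i<R
    ... | no  i≮R =
      let j , j′ , j<j′ , same = pigeonhole (ℕ.s≤s (ℕ.≮⇒≥ i≮R)) (proj₁ ∘ step)
      in  ⊥-elim (<⇒≢ j<j′ (toℕ-injective
            (walk-index-unique (proj₂ (step j)) (subst (Walk (toℕ j′)) (sym same) (proj₂ (step j′))))))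
      where
      step : (j : Fin (suc i)) → ∃ (Walk (toℕ j))
      step j = walk-prefix w (toℕ j) (ℕ.s≤s⁻¹ (toℕ<n j))

    InChain : Fin R → Set
    InChain b = ∃ λ (i : Fin R) → Walk (toℕ i) b

    inChain? : Decidable InChain
    inChain? b = any? (λ i → walk? (toℕ i) b)

    walk⇒inChain : ∀ {i b} → Walk i b → InChain b
    walk⇒inChain {i} {b} w = fromℕ< (walk-length< w) , subst (λ j → Walk j b) (sym (toℕ-fromℕ< _)) w

    chain-closed : ∀ {a b} → Link T α β a b → (InChain a → InChain b) × (InChain b → InChain a)
    chain-closed {a} {b} l = (λ (i , w) → walk⇒inChain {suc (toℕ i)} (a , w , l)) , backward
      where
      backward : InChain b → InChain a
      backward (i , w) with toℕ i | w
      ... | zero  | refl = ⊥-elim (no-link-into-r₁ l)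
      ... | suc j | a′ , w′ , l′ with link-injective l′ l
      ...   | refl = walk⇒inChain w′

    chain-filled-at-α : ∀ {b} → InChain b → T b α ≢ nothing
    chain-filled-at-α (i , w) with toℕ i | w
    ... | zero  | refl = λ r₁-empty → just≢nothing (trans (sym r₁-α) r₁-empty)
    ... | suc _ | _ , _ , _ , _ , q = λ b-empty → just≢nothing (trans (sym q) b-empty)

    s-at-α⇒inChain : ∀ {b} → T b α ≡ just s → InChain b
    s-at-α⇒inChain b-α = subst InChain (column-latin r₁-α b-α) (walk⇒inChain {zero} refl)

  insertion-via : ∀ {T T′ : Array R K N} {r₀ s} →
    (∀ {r y} → InRow T r y → InRow T′ r y) → (∀ {r y} → InRow T′ r y → InRow T r y) →
    Insertion T′ r₀ s → Insertion T r₀ s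
  insertion-via T⊆T′ T′⊆T ins = record
    { Insertion ins
    ; keeps     = keeps ∘ T⊆T′
    ; adds-only = map₁ T′⊆T ∘ adds-only }
    where open Insertion ins

  -- An alternating α/β swap along the Kempe chain of the row holding s in column α
  -- frees column α of s without touching row r₀.
  insert : ∀ {T : Array R K N} {r₀ α β s} → RowLatin T → ColumnLatin T →
           T r₀ α ≡ nothing → ¬ InColumn T β s → ¬ InRow T r₀ s → Insertion T r₀ s
  insert {T} {r₀} {α} {β} {s} row-latin column-latin r₀-α s∉β s∉r₀
    with any? (λ r → ≡-dec _≟_ (T r α) (just s))
  ... | no  s∉α = Place.place T r₀ α s row-latin column-latin r₀-α s∉r₀ s∉α
  ... | yes (r₁ , r₁-α) =
    insertion-via swapped-keeps swapped-adds-nothing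
      (Place.place swapped r₀ α s (swapped-row-latin row-latin) (swapped-column-latin column-latin)
                   r₀-α′ (s∉r₀ ∘ swapped-adds-nothing) s∉α′)
    where
    open KempeChain T column-latin α β s∉β r₁-α
    open Swap T α β inChain? chain-closed

    r₀∉chain : ¬ InChain r₀
    r₀∉chain r₀∈ = chain-filled-at-α r₀∈ r₀-α

    r₀-α′ : swapped r₀ α ≡ nothing
    r₀-α′ = trans (swapped-outside r₀∉chain α) r₀-α

    s∉α′ : ¬ InColumn swapped α s
    s∉α′ (r , p) with swapped-view r α
    ... | inj₁ (_ , q) = s∉β (r , trans (sym (trans q (cong (T r) (transpose-at-i α β)))) p)
    ... | inj₂ (r∉ , q) = r∉ (s-at-α⇒inChain (trans (sym q) p))

-- Each symbol occurs in at most one row per band, hence in at most K rows: this is the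
-- degree bound under which König's edge-colouring argument fits the rows into K columns.
module Arrangement {R K N : ℕ} (S : Fin R → Fin K → Fin N) (S-injective : ∀ r → Injective _≡_ _≡_ (S r))
                   (band : Fin R → Fin K)
                   (band-separates : ∀ {r r′ x x′} → S r x ≡ S r′ x′ → band r ≡ band r′ → r ≡ r′) where

  Within : Array R K N → Set
  Within T = ∀ {r c y} → T r c ≡ just y → ∃ λ x → S r x ≡ y

  module _ {T : Array R K N} (row-latin : RowLatin T) (within : Within T) where

    full-row-contains-all : ∀ {r} → (∀ c → IsDefined (T r c)) → ∀ x → InRow T r (S r x)
    full-row-contains-all {r} full x =
      let c , fc≡x = injective⇒surjective f f-injective x
      in  c , trans (cell c) (cong just (trans (sym (f-spec c)) (cong (S r) fc≡x)))
      where
      content : Fin K → Fin N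
      content c = proj₁ (full c)
      cell : ∀ c → T r c ≡ just (content c)
      cell c = proj₂ (full c)
      f : Fin K → Fin K
      f c = proj₁ (within (cell c))
      f-spec : ∀ c → S r (f c) ≡ content c
      f-spec c = proj₂ (within (cell c))
      f-injective : Injective _≡_ _≡_ f
      f-injective {c} {c′} fc≡fc′ =
        row-latin (cell c) (subst (λ y → T r c′ ≡ just y) same-content (cell c′))
        where
        same-content : content c′ ≡ content c
        same-content = trans (sym (f-spec c′)) (trans (cong (S r) (sym fc≡fc′)) (f-spec c))

    row-has-room : ∀ {r x} → ¬ InRow T r (S r x) → ∃ λ c → T r c ≡ nothing
    row-has-room {r} {x} missing =
      decidable-stable (any? (λ c → ≡-dec _≟_ (T r c) nothing))
        (λ no-room → missing (full-row-contains-all (full no-room) x))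
      where
      full : ¬ (∃ λ c → T r c ≡ nothing) → ∀ c → IsDefined (T r c)
      full no-room c with defined-or-empty (T r c)
      ... | inj₁ defined = defined
      ... | inj₂ empty = ⊥-elim (no-room (c , empty))

    column-without : ∀ {r x} → ¬ InRow T r (S r x) → ∃ λ β → ¬ InColumn T β (S r x)
    column-without {r} {x} missing =
      decidable-stable (any? (λ β → ¬? (any? (λ r′ → ≡-dec _≟_ (T r′ β) (just (S r x))))))
        clash
      where
      module _ (none : ¬ ∃ λ β → ¬ InColumn T β (S r x)) where
        occurrence : ∀ c → InColumn T c (S r x)
        occurrence c = decidable-stable (any? (λ r′ → ≡-dec _≟_ (T r′ c) (just (S r x)))) (λ ∉ → none (c , ∉))
        holder : Fin K → Fin R
        holder c = proj₁ (occurrence c)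
        holder-cell : ∀ c → T (holder c) c ≡ just (S r x)
        holder-cell c = proj₂ (occurrence c)
        holder-symbol : ∀ c → ∃ λ x′ → S (holder c) x′ ≡ S r x
        holder-symbol c = within (holder-cell c)
        same-row : ∀ c → band (holder c) ≡ band r → holder c ≡ r
        same-row c = band-separates (proj₂ (holder-symbol c))
        holder-injective : Injective _≡_ _≡_ (band ∘ holder)
        holder-injective {c} {c′} band≡ =
          row-latin (holder-cell c) (subst (λ r′ → T r′ c′ ≡ just (S r x)) (sym holder≡) (holder-cell c′))
          where
          holder≡ : holder c ≡ holder c′
          holder≡ = band-separates (trans (proj₂ (holder-symbol c)) (sym (proj₂ (holder-symbol c′)))) band≡
        clash : ⊥
        clash =
          let c , band≡ = injective⇒surjective (band ∘ holder) holder-injective (band r)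
          in  missing (c , subst (λ r′ → T r′ c ≡ just (S r x)) (same-row c band≡) (holder-cell c))

  contains-all⇒full : ∀ {T : Array R K N} {r} → (∀ x → InRow T r (S r x)) → ∀ c → IsDefined (T r c)
  contains-all⇒full {T} {r} contains c =
    let x , column≡c = injective⇒surjective column column-injective c
    in  S r x , subst (λ c′ → T r c′ ≡ just (S r x)) column≡c (proj₂ (contains x))
    where
    column : Fin K → Fin K
    column x = proj₁ (contains x)
    column-injective : Injective _≡_ _≡_ column
    column-injective {x} {x′} column≡ =
      S-injective r (just-injective (trans (sym (proj₂ (contains x)))
        (trans (cong (T r) column≡) (proj₂ (contains x′)))))

  position : Fin R → Fin K → ℕ
  position r x = toℕ (combine r x)

  record Stage (i : ℕ) : Set where
    field
      array        : Array R K N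
      row-latin    : RowLatin array
      column-latin : ColumnLatin array
      sound        : ∀ {r c y} → array r c ≡ just y → ∃ λ x → S r x ≡ y × position r x < i
      complete     : ∀ r x → position r x < i → InRow array r (S r x)

  stage₀ : Stage 0
  stage₀ = record
    { array = λ _ _ → nothing
    ; row-latin = λ ()
    ; column-latin = λ ()
    ; sound = λ ()
    ; complete = λ _ _ () }

  module _ {i : ℕ} {r₀ : Fin R} {x₀ : Fin K} (st : Stage i) (position₀ : position r₀ x₀ ≡ i) where
    open Stage st

    not-yet-placed : ¬ InRow array r₀ (S r₀ x₀)
    not-yet-placed (c , p) =
      let x , Sx≡Sx₀ , x<i = sound p
      in  ℕ.<-irrefl (trans (cong (position r₀) (S-injective r₀ Sx≡Sx₀)) position₀) x<i

    module _ (ins : Insertion array r₀ (S r₀ x₀)) where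
      open Insertion ins renaming (array to array′; row-latin to row-latin′; column-latin to column-latin′)

      sound′ : ∀ {r c y} → array′ r c ≡ just y → ∃ λ x → S r x ≡ y × position r x < suc i
      sound′ {r} {c} p with adds-only (c , p)
      ... | inj₁ (_ , q) = let x , Sx≡y , x<i = sound q in x , Sx≡y , ℕ.m≤n⇒m≤1+n x<i
      ... | inj₂ (refl , refl) = x₀ , refl , ℕ.≤-reflexive (cong suc position₀)

      complete′ : ∀ r x → position r x < suc i → InRow array′ r (S r x)
      complete′ r x x<1+i with ℕ.m≤n⇒m<n∨m≡n (ℕ.s≤s⁻¹ x<1+i)
      ... | inj₁ x<i = keeps (complete r x x<i)
      ... | inj₂ x≡i with combine-injective r x r₀ x₀ (toℕ-injective (trans x≡i (sym position₀)))
      ...   | refl , refl = inserts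

      stage-after-insertion : Stage (suc i)
      stage-after-insertion = record
        { array = array′ ; row-latin = λ {r} → row-latin′ {r} ; column-latin = column-latin′
        ; sound = sound′ ; complete = complete′ }

    next-stage : Stage (suc i)
    next-stage =
      let within : Within array
          within p = let x , q , _ = sound p in x , q
      in  stage-after-insertion
            (insert row-latin column-latin (proj₂ (row-has-room row-latin within not-yet-placed))
                    (proj₂ (column-without row-latin within not-yet-placed)) not-yet-placed)

  stage : ∀ i → i ≤ R * K → Stage i
  stage zero    _      = stage₀
  stage (suc i) i<R*K =
    let r₀ , x₀ , combine≡ = combine-surjective {R} {K} (fromℕ< i<R*K)
    in  next-stage {r₀ = r₀} {x₀} (stage i (ℕ.<⇒≤ i<R*K)) (trans (cong toℕ combine≡) (toℕ-fromℕ< i<R*K))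

  record LatinArrangement : Set where
    field
      entry            : Fin R → Fin K → Fin N
      entry-in-row     : ∀ r c → ∃ λ x → S r x ≡ entry r c
      row-injective    : ∀ r → Injective _≡_ _≡_ (entry r)
      column-injective : ∀ c → Injective _≡_ _≡_ (λ r → entry r c)

  opaque
    latin-arrangement : LatinArrangement
    latin-arrangement = record
      { entry = entry
      ; entry-in-row = λ r c → let x , Sx≡ , _ = sound (cell r c) in x , Sx≡
      ; row-injective = λ r {c} {c′} eq → row-latin (cell r c) (trans (cell r c′) (cong just (sym eq)))
      ; column-injective = λ c {r} {r′} eq → column-latin (cell r c) (trans (cell r′ c) (cong just (sym eq))) }
      where
      open Stage (stage (R * K) ℕ.≤-refl)
      full : ∀ r c → IsDefined (array r c)
      full r = contains-all⇒full {array} (λ x → complete r x (toℕ<n (combine r x)))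
      entry : Fin R → Fin K → Fin N
      entry r c = proj₁ (full r c)
      cell : ∀ r c → array r c ≡ just (entry r c)
      cell r c = proj₂ (full r c)

%-congˡ-+ʳ : ∀ {x y} c {n} .{{_ : NonZero n}} → x % n ≡ y % n → (x + c) % n ≡ (y + c) % n
%-congˡ-+ʳ {x} {y} c {n} eq = begin
  (x + c) % n             ≡⟨ %-distribˡ-+ x c n ⟩
  (x % n + c % n) % n     ≡⟨ cong (λ z → (z + c % n) % n) eq ⟩
  (y % n + c % n) % n     ≡⟨ %-distribˡ-+ y c n ⟨
  (y + c) % n             ∎

+-%-cancelʳ : ∀ {a a′ b n} .{{_ : NonZero n}} → a < n → a′ < n → b ≤ n →
              (a + b) % n ≡ (a′ + b) % n → a ≡ a′
+-%-cancelʳ {a} {a′} {b} {n} a<n a′<n b≤n eq = begin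
  a                        ≡⟨ m<n⇒m%n≡m a<n ⟨
  a % n                    ≡⟨ undo a ⟨
  (a + b + (n ∸ b)) % n    ≡⟨ %-congˡ-+ʳ (n ∸ b) eq ⟩
  (a′ + b + (n ∸ b)) % n   ≡⟨ undo a′ ⟩
  a′ % n                   ≡⟨ m<n⇒m%n≡m a′<n ⟩
  a′                       ∎
  where
  undo : ∀ x → (x + b + (n ∸ b)) % n ≡ x % n
  undo x = trans (cong (_% n) (trans (ℕ.+-assoc x b (n ∸ b)) (cong (x +_) (ℕ.m+[n∸m]≡n b≤n))))
                 ([m+n]%n≡m%n x n)

module _ {k : ℕ} where

  cyclic : Fin (suc k) → Fin (suc k) → Fin (suc k)
  cyclic i j = fromℕ< (m%n<n (toℕ i + toℕ j) (suc k))

  toℕ-cyclic : ∀ i j → toℕ (cyclic i j) ≡ (toℕ i + toℕ j) % suc k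
  toℕ-cyclic i j = toℕ-fromℕ< (m%n<n (toℕ i + toℕ j) (suc k))

  cyclic-identityʳ : ∀ i → cyclic i Fin.zero ≡ i
  cyclic-identityʳ i = toℕ-injective (begin
    toℕ (cyclic i Fin.zero)  ≡⟨ toℕ-cyclic i Fin.zero ⟩
    (toℕ i + 0) % suc k      ≡⟨ cong (_% suc k) (ℕ.+-identityʳ (toℕ i)) ⟩
    toℕ i % suc k            ≡⟨ m<n⇒m%n≡m (toℕ<n i) ⟩
    toℕ i                    ∎)

  cyclic-comm : ∀ i j → cyclic i j ≡ cyclic j i
  cyclic-comm i j = toℕ-injective (begin
    toℕ (cyclic i j)        ≡⟨ toℕ-cyclic i j ⟩
    (toℕ i + toℕ j) % suc k ≡⟨ cong (_% suc k) (ℕ.+-comm (toℕ i) (toℕ j)) ⟩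
    (toℕ j + toℕ i) % suc k ≡⟨ toℕ-cyclic j i ⟨
    toℕ (cyclic j i)        ∎)

  cyclic-cancelʳ : ∀ {i i′} j → cyclic i j ≡ cyclic i′ j → i ≡ i′
  cyclic-cancelʳ {i} {i′} j eq = toℕ-injective
    (+-%-cancelʳ (toℕ<n i) (toℕ<n i′) (ℕ.<⇒≤ (toℕ<n j))
      (trans (sym (toℕ-cyclic i j)) (trans (cong toℕ eq) (toℕ-cyclic i′ j))))

  cyclic-cancelˡ : ∀ i {j j′} → cyclic i j ≡ cyclic i j′ → j ≡ j′
  cyclic-cancelˡ i {j} {j′} eq = cyclic-cancelʳ i (trans (cyclic-comm j i) (trans eq (cyclic-comm i j′)))

combine-/ : ∀ {m n} (i : Fin m) (j : Fin (suc n)) → toℕ (combine i j) / suc n ≡ toℕ i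
combine-/ {m} {n} i j = begin
  toℕ (combine i j) / suc n             ≡⟨ cong (_/ suc n) (toℕ-combine i j) ⟩
  (suc n * toℕ i + toℕ j) / suc n       ≡⟨ +-distrib-/-∣ˡ (toℕ j) (m∣m*n (toℕ i)) ⟩
  suc n * toℕ i / suc n + toℕ j / suc n ≡⟨ cong₂ _+_ (cong (_/ suc n) (ℕ.*-comm (suc n) (toℕ i))) (m<n⇒m/n≡0 (toℕ<n j)) ⟩
  toℕ i * suc n / suc n + 0             ≡⟨ ℕ.+-identityʳ _ ⟩
  toℕ i * suc n / suc n                 ≡⟨ m*n/n≡m (toℕ i) (suc n) ⟩
  toℕ i                                 ∎

quotient-remainder-injective : ∀ {m} n {i j : Fin (m * n)} →
  quotient {m} n i ≡ quotient {m} n j → remainder {m} n i ≡ remainder {m} n j → i ≡ j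
quotient-remainder-injective {m} n {i} {j} q≡ r≡ = begin
  i                                              ≡⟨ combine-remQuot {m} n i ⟨
  combine (quotient {m} n i) (remainder {m} n i)     ≡⟨ cong₂ combine q≡ r≡ ⟩
  combine (quotient {m} n j) (remainder {m} n j)     ≡⟨ combine-remQuot {m} n j ⟩
  j                                              ∎

toℕ-quotient : ∀ {m} n (i : Fin (m * suc n)) → toℕ i / suc n ≡ toℕ (quotient {m} (suc n) i)
toℕ-quotient {m} n i =
  trans (cong (λ j → toℕ j / suc n) (sym (combine-remQuot {m} (suc n) i)))
        (combine-/ (quotient (suc n) i) (remainder {m} (suc n) i))

/≡⇒quotient≡ : ∀ {m} n {i j : Fin (m * suc n)} → toℕ i / suc n ≡ toℕ j / suc n →
               quotient {m} (suc n) i ≡ quotient (suc n) j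
/≡⇒quotient≡ {m} n {i} {j} eq = toℕ-injective (trans (sym (toℕ-quotient {m} n i)) (trans eq (toℕ-quotient n j)))

first-rows : ∀ {n} → ℕ → (Fin n → Fin n → Fin n) → Matrix n
first-rows p V r c with toℕ r ℕ.<? p
... | yes _ = just (V r c)
... | no  _ = nothing

module _ {n p : ℕ} (V : Fin n → Fin n → Fin n) where

  first-rows-just : ∀ {r c s} → first-rows p V r c ≡ just s → toℕ r < p × V r c ≡ s
  first-rows-just {r} eq with toℕ r ℕ.<? p
  ... | yes r<p = r<p , just-injective eq

  first-rows-filled : ∀ {r c} → toℕ r < p → first-rows p V r c ≡ just (V r c)
  first-rows-filled {r} r<p with toℕ r ℕ.<? p
  ... | yes _   = refl
  ... | no  r≮p = ⊥-elim (r≮p r<p)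

  first-rows-empty : ∀ {r c} → p ≤ toℕ r → first-rows p V r c ≡ nothing
  first-rows-empty {r} p≤r with toℕ r ℕ.<? p
  ... | yes r<p = ⊥-elim (ℕ.<⇒≱ r<p p≤r)
  ... | no  _   = refl

  first-rows-extends : ∀ {P : Matrix n} → (∀ {r c s} → P r c ≡ just s → toℕ r < p × V r c ≡ s) →
                      Extends P (first-rows p V)
  first-rows-extends agrees r c s eq = let r<p , Vrc≡s = agrees eq in trans (first-rows-filled r<p) (cong just Vrc≡s)

first-rows-rectangle : ∀ {k p} (V : Fin (suc k * suc k) → Fin (suc k * suc k) → Fin (suc k * suc k)) →
  (∀ {r c c′} → V r c ≡ V r c′ → c ≡ c′) →
  (∀ {r r′ c} → toℕ r < p → toℕ r′ < p → V r c ≡ V r′ c → r ≡ r′) →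
  (∀ {r c r′ c′} → SameBlock k r c r′ c′ → V r c ≡ V r′ c′ → r ≡ r′) →
  SudokuRectangle k p (suc k * suc k) (first-rows p V)
first-rows-rectangle {k} {p} V row-injective column-injective block-injective = record
  { partial = record
    { rowOK   = λ r c c′ s eq eq′ → row-injective (symbols-agree eq eq′)
    ; colOK   = λ r r′ c s eq eq′ → column-injective (proj₁ (first-rows-just V eq)) (proj₁ (first-rows-just V eq′))
                                                     (symbols-agree eq eq′)
    ; blockOK = λ r c r′ c′ s same eq eq′ → block-cells same (symbols-agree eq eq′) }
  ; filled  = λ r c r<p _ empty → just≢nothing (trans (sym (first-rows-filled V r<p)) empty)
  ; empty   = λ { r c (inj₁ p≤r) → first-rows-empty V p≤r
                ; r c (inj₂ n≤c) → ⊥-elim (ℕ.<⇒≱ (toℕ<n c) n≤c) } }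
  where
  symbols-agree : ∀ {r c r′ c′ s} → first-rows p V r c ≡ just s → first-rows p V r′ c′ ≡ just s →
                  V r c ≡ V r′ c′
  symbols-agree eq eq′ = trans (proj₂ (first-rows-just V eq)) (sym (proj₂ (first-rows-just V eq′)))
  block-cells : ∀ {r c r′ c′} → SameBlock k r c r′ c′ → V r c ≡ V r′ c′ → r ≡ r′ × c ≡ c′
  block-cells same eq with block-injective same eq
  ... | refl = refl , row-injective eq

module Completion (k m : ℕ) (P : Matrix (suc k * suc k)) (rect : SudokuRectangle k m (suc k) P) where
  open SudokuRectangle rect
  open PartialSudoku partial

  K : ℕ
  K = suc k

  band : Fin (K * K) → Fin K
  band = quotient K

  offset : Fin (K * K) → Fin K
  offset = remainder {K} K

  stack : Fin (K * K) → Fin K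
  stack = quotient K

  slot : Fin (K * K) → Fin K
  slot = remainder {K} K

  row-injective : ∀ {r r′} → band r ≡ band r′ → offset r ≡ offset r′ → r ≡ r′
  row-injective = quotient-remainder-injective K

  first-stack : Fin K → Fin (K * K)
  first-stack = combine {K} Fin.zero

  toℕ-first-stack : ∀ l → toℕ (first-stack l) ≡ toℕ l
  toℕ-first-stack l = trans (toℕ-combine {K} {K} Fin.zero l) (cong (_+ toℕ l) (ℕ.*-zeroʳ K))

  first-block : Fin K → Fin (K * K) → Maybe (Fin (K * K))
  first-block b z = P (combine b (quotient K z)) (first-stack (remainder {K} K z))

  first-block-injective : ∀ b → PartialInjection (first-block b)
  first-block-injective b {z} {z′} eq eq′ =
    let r≡ , c≡ = blockOK _ _ _ _ _ same-block eq eq′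
    in  quotient-remainder-injective {K} K (proj₂ (combine-injective b i b i′ r≡))
                                       (proj₂ (combine-injective {K} Fin.zero l Fin.zero l′ c≡))
    where
    i i′ l l′ : Fin K
    i = quotient K z
    l = remainder {K} K z
    i′ = quotient K z′
    l′ = remainder {K} K z′
    same-block : SameBlock k (combine b i) (first-stack l) (combine b i′) (first-stack l′)
    same-block = trans (combine-/ b i) (sym (combine-/ b i′))
               , trans (combine-/ {K} Fin.zero l) (sym (combine-/ {K} Fin.zero l′))

  opaque
    extension : ∀ b → ∃ λ f → Injective _≡_ _≡_ f × (∀ {z v} → first-block b z ≡ just v → f z ≡ v)
    extension b = extend-partial-injection (first-block-injective b)

    completed : Fin K → Fin K → Fin K → Fin (K * K)
    completed b i l = proj₁ (extension b) (combine i l)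

    completed-injective : ∀ {b i l i′ l′} → completed b i l ≡ completed b i′ l′ → i ≡ i′ × l ≡ l′
    completed-injective {b} {i} {l} {i′} {l′} eq = combine-injective i l i′ l′ (proj₁ (proj₂ (extension b)) eq)

    completed-extends : ∀ {b i l v} → P (combine b i) (first-stack l) ≡ just v → completed b i l ≡ v
    completed-extends {b} {i} {l} {v} eq =
      proj₂ (proj₂ (extension b))
        (subst (λ (i′ , l′) → P (combine b i′) (first-stack l′) ≡ just v) (sym (remQuot-combine i l)) eq)

  first-stack-entry : ∀ {r} l → toℕ r < m → P r (first-stack l) ≡ just (completed (band r) (offset r) l)
  first-stack-entry {r} l r<m with defined-or-empty (P r (first-stack l))
  ... | inj₂ empty-cell =
    ⊥-elim (filled r (first-stack l) r<m (subst (_< K) (sym (toℕ-first-stack l)) (toℕ<n l)) empty-cell)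
  ... | inj₁ (v , eq) =
    trans eq (cong just (sym (completed-extends (subst (λ r′ → P r′ (first-stack l) ≡ just v)
                                                       (sym (combine-remQuot {K} K r)) eq))))

  symbols : Fin K → Fin (K * K) → Fin K → Fin (K * K)
  symbols j r = completed (band r) (cyclic (offset r) j)

  symbols-injective : ∀ j r → Injective _≡_ _≡_ (symbols j r)
  symbols-injective j r = proj₂ ∘ completed-injective

  symbols-separate : ∀ {j r r′ x x′} → symbols j r x ≡ symbols j r′ x′ → band r ≡ band r′ → r ≡ r′
  symbols-separate {j} {r} {r′} {x} {x′} eq band≡ =
    row-injective band≡ (cyclic-cancelʳ j (proj₁ (completed-injective
      (subst (λ b → symbols j r x ≡ completed b (cyclic (offset r′) j) x′) (sym band≡) eq))))

  module Stack (j : Fin K) = Arrangement (symbols j) (symbols-injective j) band symbols-separate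
  module Arranged (j : Fin K) = Stack.LatinArrangement j (Stack.latin-arrangement j)

  -- Stack 0 keeps the completed first blocks themselves, so that the square extends P.
  entry : Fin (K * K) → Fin K → Fin K → Fin (K * K)
  entry r Fin.zero    l = completed (band r) (offset r) l
  entry r (Fin.suc j) l = Arranged.entry (Fin.suc j) r l

  entry-in-row : ∀ r j l → ∃ λ x → symbols j r x ≡ entry r j l
  entry-in-row r Fin.zero    l = l , cong (λ i → completed (band r) i l) (cyclic-identityʳ (offset r))
  entry-in-row r (Fin.suc j) l = Arranged.entry-in-row (Fin.suc j) r l

  entry-stack-injective : ∀ {r j j′ l l′} → entry r j l ≡ entry r j′ l′ → j ≡ j′
  entry-stack-injective {r} {j} {j′} {l} {l′} eq =
    let x , x-entry = entry-in-row r j l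
        x′ , x′-entry = entry-in-row r j′ l′
    in  cyclic-cancelˡ (offset r) (proj₁ (completed-injective (trans x-entry (trans eq (sym x′-entry)))))

  entry-position-injective : ∀ {r j l l′} → entry r j l ≡ entry r j l′ → l ≡ l′
  entry-position-injective {j = Fin.zero}  eq = proj₂ (completed-injective eq)
  entry-position-injective {r} {Fin.suc j} eq = Arranged.row-injective (Fin.suc j) r eq

  entry-column-injective : ∀ {r r′ j l} → toℕ r < m → toℕ r′ < m → entry r j l ≡ entry r′ j l → r ≡ r′
  entry-column-injective {r} {r′} {Fin.zero} {l} r<m r′<m eq =
    colOK r r′ (first-stack l) _ (first-stack-entry l r<m) (trans (first-stack-entry l r′<m) (cong just (sym eq)))
  entry-column-injective {j = Fin.suc j} {l} _ _ eq = Arranged.column-injective (Fin.suc j) l eq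

  entry-band-injective : ∀ {r r′ j l l′} → band r ≡ band r′ → entry r j l ≡ entry r′ j l′ → r ≡ r′
  entry-band-injective {r} {r′} {j} {l} {l′} band≡ eq =
    let x , x-entry = entry-in-row r j l
        x′ , x′-entry = entry-in-row r′ j l′
    in  symbols-separate (trans x-entry (trans eq (sym x′-entry))) band≡

  inside-rectangle : ∀ {r c s} → P r c ≡ just s → toℕ r < m × toℕ c < K
  inside-rectangle {r} {c} eq with toℕ r ℕ.<? m | toℕ c ℕ.<? K
  ... | yes r<m | yes c<K = r<m , c<K
  ... | no  r≮m | _       = ⊥-elim (just≢nothing (trans (sym eq) (empty r c (inj₁ (ℕ.≮⇒≥ r≮m)))))
  ... | _       | no  c≮K = ⊥-elim (just≢nothing (trans (sym eq) (empty r c (inj₂ (ℕ.≮⇒≥ c≮K)))))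

  opaque
    square : Fin (K * K) → Fin (K * K) → Fin (K * K)
    square r c = entry r (stack c) (slot c)

  opaque
    unfolding square

    square-row-injective : ∀ {r c c′} → square r c ≡ square r c′ → c ≡ c′
    square-row-injective {r} {c} {c′} eq =
      let stack≡ = entry-stack-injective {r} {stack c} {stack c′} {slot c} {slot c′} eq
      in  quotient-remainder-injective {K} K stack≡
            (entry-position-injective {r} {stack c′}
              (subst (λ j → entry r j (slot c) ≡ square r c′) stack≡ eq))

    square-column-injective : ∀ {r r′ c} → toℕ r < m → toℕ r′ < m → square r c ≡ square r′ c → r ≡ r′
    square-column-injective {r} {r′} {c} = entry-column-injective {r} {r′} {stack c} {slot c}

    square-block-injective : ∀ {r c r′ c′} → SameBlock k r c r′ c′ → square r c ≡ square r′ c′ → r ≡ r′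
    square-block-injective {r} {c} {r′} {c′} (rows , columns) eq =
      entry-band-injective {r} {r′} {stack c′} {slot c} {slot c′} (/≡⇒quotient≡ {K} k {r} {r′} rows)
        (subst (λ j → entry r j (slot c) ≡ square r′ c′) (/≡⇒quotient≡ {K} k {c} {c′} columns) eq)

    square-extends : ∀ {r c s} → P r c ≡ just s → toℕ r < m × square r c ≡ s
    square-extends {r} {c} {s} eq = r<m , (begin
      square r c                              ≡⟨ cong (λ j → entry r j (slot c)) stack≡0 ⟩
      completed (band r) (offset r) (slot c)  ≡⟨ just-injective (trans (sym (first-stack-entry (slot c) r<m))
                                                                       (trans (cong (P r) c≡) eq)) ⟩
      s                                       ∎)
      where
      r<m : toℕ r < m
      r<m = proj₁ (inside-rectangle eq)
      stack≡0 : stack c ≡ Fin.zero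
      stack≡0 = toℕ-injective (trans (sym (toℕ-quotient {K} k c)) (m<n⇒m/n≡0 (proj₂ (inside-rectangle eq))))
      c≡ : first-stack (slot c) ≡ c
      c≡ = trans (cong (λ j → combine j (slot c)) (sym stack≡0)) (combine-remQuot {K} K c)

lemma1 : (k m : ℕ) → m ≤ suc k * suc k →
         (P : Matrix (suc k * suc k)) → SudokuRectangle k m (suc k) P →
         Σ (Matrix (suc k * suc k)) λ Q →
           SudokuRectangle k m (suc k * suc k) Q × Extends P Q
lemma1 k m _ P rect =
    first-rows m square
  , first-rows-rectangle square square-row-injective square-column-injective square-block-injective
  , first-rows-extends square square-extends
  where open Completion k m P rect
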